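{- There exists a universal $G_\delta$ set $U\subseteq 2^\omega\times 2^\omega$ such that for all $x_1,x_2\in 2^\omega$, if $x_1=^*x_2$ then $U(x_1)=U(x_2)$.
   Context: For $U\subseteq 2^\omega\times2^\omega$ and $x\in 2^\omega$, $U(x)=\{y\in 2^\omega:(x,y)\in U\}$. $U$ is a universal $G_\delta$ set iff $U$ is $G_\delta$ in $2^\omega\times 2^\omega$ and for every $G_\delta$ set $V\subseteq 2^\omega$ there is $x\in 2^\omega$ with $U(x)=V$. $x_1=^*x_2$ means $x_1(n)=x_2(n)$ for all but finitely many $n$. -}

module Defs where

open import Data.Bool using (Bool; true)
open import Level using () renaming (suc to lsuc)
open import Data.Nat using (ℕ; _≤_)
open import Data.List using (List; map; upTo)
open import Data.Product using (Σ; ∃; _×_)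
open import Relation.Binary.PropositionalEquality using (_≡_)

Cantor : Set
Cantor = ℕ → Bool

prefix : Cantor → ℕ → List Bool
prefix x n = map x (upTo n)

StringSet : Set
StringSet = List Bool → Bool

-- The open subset of 2^ω coded by W: union of basic clopen sets [s], s ∈ W.
InOpen : StringSet → Cantor → Set
InOpen W y = ∃ λ n → W (prefix y n) ≡ true

IsGδ : (Cantor → Set) → Set
IsGδ V = Σ (ℕ → StringSet) λ W → ∀ y → (V y → ∀ k → InOpen (W k) y) × ((∀ k → InOpen (W k) y) → V y)

-- Open subsets of 2^ω × 2^ω: unions of basic open rectangles [s]×[t]
-- with |s| = |t| (these form a base of the product topology).
PairStringSet : Set
PairStringSet = List Bool → List Bool → Bool

InOpen₂ : PairStringSet → Cantor → Cantor → Set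
InOpen₂ W x y = ∃ λ n → W (prefix x n) (prefix y n) ≡ true

IsGδ₂ : (Cantor → Cantor → Set) → Set
IsGδ₂ U = Σ (ℕ → PairStringSet) λ W → ∀ x y → (U x y → ∀ k → InOpen₂ (W k) x y) × ((∀ k → InOpen₂ (W k) x y) → U x y)

SameSection : (Cantor → Cantor → Set) → Cantor → (Cantor → Set) → Set
SameSection U x V = ∀ y → (U x y → V y) × (V y → U x y)

IsUniversalGδ : (Cantor → Cantor → Set) → Set₁
IsUniversalGδ U = IsGδ₂ U × (∀ (V : Cantor → Set) → IsGδ V → ∃ λ x → SameSection U x V)

_=*_ : Cantor → Cantor → Set
x₁ =* x₂ = ∃ λ N → ∀ n → N ≤ n → x₁ n ≡ x₂ n

-- Every natural number i carries a label (k, N, s) with s a finite binary string, and every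
-- label is carried by some i ≥ N.  Read x(i) = 1 as "x puts the basic set [s] into the k-th
-- open set", and let y ∈ U(x) iff for all k and N some i ≥ N with x(i) = 1 and label index k
-- has y ∈ [s].  Each condition "for this k and N" is open in (x, y), and the pairs (k, N) are
-- enumerated by the labels themselves, so U is G_δ.  Taking x(i) = W_k(s) shows that every
-- G_δ set ⋂ₖ ⋃_{s ∈ W_k} [s] is a section.  Since N is arbitrary, U(x) depends only on the
-- tail of x.
module Submission where

open import Defs
open import Data.Bool using (Bool; true; false)
import Data.Bool as Bool
open import Data.Bool.Properties using (T-≡)
open import Data.List using (List; []; _∷_; length; replicate; take; applyUpTo; _++_)
open import Data.List.Properties using (map-applyUpTo; length-applyUpTo; length-replicate; length-++-≤ˡ; ≡-dec)
open import Data.Nat using (ℕ; zero; suc; _+_; _≤_; _<_; _≤?_; z≤n; s≤s)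
import Data.Nat as ℕ
open import Data.Nat.Binary using (ℕᵇ; 2[1+_]; 1+[2_]; toℕ; fromℕ)
import Data.Nat.Binary as ℕᵇ
open import Data.Nat.Binary.Properties using (fromℕ-toℕ)
open import Data.Nat.Properties using (≤-trans; m≤m+n; m≤n+m; anyUpTo?; module ≤-Reasoning)
open import Data.Product using (Σ; ∃; _×_; _,_; proj₁; proj₂)
open import Function using (_∘_)
open import Function.Bundles using (Equivalence)
open import Relation.Nullary.Decidable using (Dec; ⌊_⌋; _×-dec_; toWitness; fromWitness)
open import Relation.Binary.PropositionalEquality

bits : ℕᵇ → List Bool
bits ℕᵇ.zero = []
bits 2[1+ n ] = true ∷ bits n
bits 1+[2 n ] = false ∷ bits n

fromBits : List Bool → ℕᵇ
fromBits [] = ℕᵇ.zero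
fromBits (true ∷ l) = 2[1+ fromBits l ]
fromBits (false ∷ l) = 1+[2 fromBits l ]

bits-fromBits : ∀ l → bits (fromBits l) ≡ l
bits-fromBits [] = refl
bits-fromBits (true ∷ l) = cong (true ∷_) (bits-fromBits l)
bits-fromBits (false ∷ l) = cong (false ∷_) (bits-fromBits l)

length≤toℕ-fromBits : ∀ l → length l ≤ toℕ (fromBits l)
length≤toℕ-fromBits [] = z≤n
length≤toℕ-fromBits (true ∷ l) = s≤s (≤-trans (length≤toℕ-fromBits l) (m≤m+n _ _))
length≤toℕ-fromBits (false ∷ l) = s≤s (≤-trans (length≤toℕ-fromBits l) (m≤m+n _ _))

readUnary : List Bool → ℕ × List Bool
readUnary [] = 0 , []
readUnary (true ∷ l) = suc (proj₁ (readUnary l)) , proj₂ (readUnary l)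
readUnary (false ∷ l) = 0 , l

readUnary-unary : ∀ k l → readUnary (replicate k true ++ false ∷ l) ≡ (k , l)
readUnary-unary zero l = refl
readUnary-unary (suc k) l rewrite readUnary-unary k l = refl

-- The label (k, N, s) of i is read off the binary digits of i, written as 1^N 0 1^k 0 s;
-- the leading 1^N makes the code of a label at least N.
record Label : Set where
  constructor label
  field
    index     : ℕ
    threshold : ℕ
    stem      : List Bool

open Label

showLabel : Label → List Bool
showLabel (label k N s) = replicate N true ++ false ∷ replicate k true ++ false ∷ s

readLabel : List Bool → Label
readLabel l = label (proj₁ (readUnary rest)) (proj₁ (readUnary l)) (proj₂ (readUnary rest))
  where
  rest : List Bool
  rest = proj₂ (readUnary l)

readLabel-showLabel : ∀ ℓ → readLabel (showLabel ℓ) ≡ ℓ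
readLabel-showLabel (label k N s)
  rewrite readUnary-unary N (replicate k true ++ false ∷ s) | readUnary-unary k s = refl

decode : ℕ → Label
decode i = readLabel (bits (fromℕ i))

encode : Label → ℕ
encode ℓ = toℕ (fromBits (showLabel ℓ))

decode-encode : ∀ ℓ → decode (encode ℓ) ≡ ℓ
decode-encode ℓ = begin
  readLabel (bits (fromℕ (toℕ (fromBits (showLabel ℓ))))) ≡⟨ cong (readLabel ∘ bits) (fromℕ-toℕ (fromBits (showLabel ℓ))) ⟩
  readLabel (bits (fromBits (showLabel ℓ)))                 ≡⟨ cong readLabel (bits-fromBits (showLabel ℓ)) ⟩
  readLabel (showLabel ℓ)                                   ≡⟨ readLabel-showLabel ℓ ⟩
  ℓ                                                         ∎
  where open ≡-Reasoning

threshold≤encode : ∀ ℓ → threshold ℓ ≤ encode ℓ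
threshold≤encode ℓ@(label _ N _) = begin
  N                                        ≡⟨ length-replicate N ⟨
  length (replicate N true)                ≤⟨ length-++-≤ˡ (replicate N true) ⟩
  length (showLabel ℓ)                     ≤⟨ length≤toℕ-fromBits (showLabel ℓ) ⟩
  encode ℓ                                 ∎
  where open ≤-Reasoning

bitAt : List Bool → ℕ → Bool
bitAt [] _ = false
bitAt (b ∷ l) zero = b
bitAt (b ∷ l) (suc i) = bitAt l i

prefix≡applyUpTo : ∀ (y : Cantor) n → prefix y n ≡ applyUpTo y n
prefix≡applyUpTo y n = map-applyUpTo (λ i → i) y n

length-prefix : ∀ y n → length (prefix y n) ≡ n
length-prefix y n = trans (cong length (prefix≡applyUpTo y n)) (length-applyUpTo y n)

bitAt-applyUpTo : ∀ (f : Cantor) {n i} → i < n → bitAt (applyUpTo f n) i ≡ f i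
bitAt-applyUpTo f {i = zero} (s≤s _) = refl
bitAt-applyUpTo f {i = suc i} (s≤s i<n) = bitAt-applyUpTo (f ∘ suc) i<n

take-applyUpTo : ∀ (f : Cantor) {m n} → m ≤ n → take m (applyUpTo f n) ≡ applyUpTo f m
take-applyUpTo f z≤n = refl
take-applyUpTo f (s≤s m≤n) = cong (f 0 ∷_) (take-applyUpTo (f ∘ suc) m≤n)

bitAt-prefix : ∀ x {n i} → i < n → bitAt (prefix x n) i ≡ x i
bitAt-prefix x {n} i<n rewrite prefix≡applyUpTo x n = bitAt-applyUpTo x i<n

take-prefix : ∀ y {m n} → m ≤ n → take m (prefix y n) ≡ prefix y m
take-prefix y {m} {n} m≤n rewrite prefix≡applyUpTo y n | prefix≡applyUpTo y m = take-applyUpTo y m≤n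

InBasic : List Bool → Cantor → Set
InBasic s y = prefix y (length s) ≡ s

InBasic-prefix : ∀ y n → InBasic (prefix y n) y
InBasic-prefix y n = cong (prefix y) (length-prefix y n)

Witness : Cantor → Cantor → ℕ → ℕ → ℕ → Set
Witness x y k N i = N ≤ i × x i ≡ true × index (decode i) ≡ k × InBasic (stem (decode i)) y

Hit : Cantor → Cantor → ℕ → ℕ → Set
Hit x y k N = ∃ (Witness x y k N)

Universal : Cantor → Cantor → Set
Universal x y = ∀ k N → Hit x y k N

=*-sym : ∀ {x₁ x₂} → x₁ =* x₂ → x₂ =* x₁
=*-sym (M , h) = M , λ n M≤n → sym (h n M≤n)

Hit-transfer : ∀ {x₁ x₂ y k N M} → (∀ n → M ≤ n → x₁ n ≡ x₂ n) → Hit x₁ y k (N + M) → Hit x₂ y k N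
Hit-transfer {N = N} {M} h (i , N+M≤i , x₁i , ki , y∈s) =
  i , ≤-trans (m≤m+n N M) N+M≤i , trans (sym (h i (≤-trans (m≤n+m M N) N+M≤i))) x₁i , ki , y∈s

Universal-=* : ∀ {x₁ x₂} → x₁ =* x₂ → ∀ y → Universal x₁ y → Universal x₂ y
Universal-=* (M , h) y u k N = Hit-transfer h (u k (N + M))

-- Witness, decided from the prefixes t = x↾n and u = y↾n alone.
WitnessIn : List Bool → List Bool → ℕ → ℕ → ℕ → Set
WitnessIn t u k N i =
  N ≤ i × bitAt t i ≡ true × index (decode i) ≡ k × length s ≤ length u × take (length s) u ≡ s
  where
  s : List Bool
  s = stem (decode i)

witnessIn? : ∀ t u k N i → Dec (WitnessIn t u k N i)
witnessIn? t u k N i =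
  N ≤? i ×-dec bitAt t i Bool.≟ true ×-dec index (decode i) ℕ.≟ k
    ×-dec length s ≤? length u ×-dec ≡-dec Bool._≟_ (take (length s) u) s
  where
  s : List Bool
  s = stem (decode i)

pairOpen : ℕ → PairStringSet
pairOpen j t u = ⌊ anyUpTo? (witnessIn? t u (index (decode j)) (threshold (decode j))) (length t) ⌋

WitnessIn-prefix⇒Witness : ∀ x y {k N i n} → i < n →
  WitnessIn (prefix x n) (prefix y n) k N i → Witness x y k N i
WitnessIn-prefix⇒Witness x y {i = i} {n} i<n (N≤i , xi , ki , |s|≤n , s≡) =
  N≤i , trans (sym (bitAt-prefix x i<n)) xi , ki ,
  trans (sym (take-prefix y (subst (length (stem (decode i)) ≤_) (length-prefix y n) |s|≤n))) s≡

Witness⇒WitnessIn-prefix : ∀ x y {k N i n} → i < n → length (stem (decode i)) ≤ n →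
  Witness x y k N i → WitnessIn (prefix x n) (prefix y n) k N i
Witness⇒WitnessIn-prefix x y {n = n} i<n |s|≤n (N≤i , xi , ki , y∈s) =
  N≤i , trans (bitAt-prefix x i<n) xi , ki ,
  subst (_ ≤_) (sym (length-prefix y n)) |s|≤n , trans (take-prefix y |s|≤n) y∈s

InOpen₂-pairOpen⇒Hit : ∀ x y j → InOpen₂ (pairOpen j) x y → Hit x y (index (decode j)) (threshold (decode j))
InOpen₂-pairOpen⇒Hit x y j (n , found) with toWitness (Equivalence.from T-≡ found)
... | i , i<|t| , w = i , WitnessIn-prefix⇒Witness x y i<n w
  where
  i<n : i < n
  i<n = subst (i <_) (length-prefix x n) i<|t|

Hit⇒InOpen₂-pairOpen : ∀ x y j → Hit x y (index (decode j)) (threshold (decode j)) → InOpen₂ (pairOpen j) x y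
Hit⇒InOpen₂-pairOpen x y j (i , w) = n , Equivalence.to T-≡ (fromWitness (i , i<|t| , w′))
  where
  |s| n : ℕ
  |s| = length (stem (decode i))
  n = suc i + |s|
  i<|t| : i < length (prefix x n)
  i<|t| = subst (i <_) (sym (length-prefix x n)) (s≤s (m≤m+n i |s|))
  w′ : WitnessIn (prefix x n) (prefix y n) (index (decode j)) (threshold (decode j)) i
  w′ = Witness⇒WitnessIn-prefix x y (s≤s (m≤m+n i |s|)) (m≤n+m |s| (suc i)) w

Universal-isGδ₂ : IsGδ₂ Universal
Universal-isGδ₂ = pairOpen , λ x y →
  (λ u j → Hit⇒InOpen₂-pairOpen x y j (u _ _)) ,
  (λ o k N → subst (λ ℓ → Hit x y (index ℓ) (threshold ℓ)) (decode-encode (label k N []))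
                   (InOpen₂-pairOpen⇒Hit x y (encode (label k N [])) (o (encode (label k N [])))))

code : (ℕ → StringSet) → Cantor
code W i = W (index (decode i)) (stem (decode i))

Hit-code⇒InOpen : ∀ W y {k N} → Hit (code W) y k N → InOpen (W k) y
Hit-code⇒InOpen W y (i , _ , marked , refl , y∈s) =
  length (stem (decode i)) , subst (λ s → W _ s ≡ true) (sym y∈s) marked

InOpen⇒Hit-code : ∀ W y {k N} → InOpen (W k) y → Hit (code W) y k N
InOpen⇒Hit-code W y {k} {N} (n , y∈W) = encode ℓ , threshold≤encode ℓ , marked , cong index decoded ,
  subst (λ ℓ′ → InBasic (stem ℓ′) y) (sym decoded) (InBasic-prefix y n)
  where
  ℓ : Label
  ℓ = label k N (prefix y n)
  decoded : decode (encode ℓ) ≡ ℓ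
  decoded = decode-encode ℓ
  marked : code W (encode ℓ) ≡ true
  marked = subst (λ ℓ′ → W (index ℓ′) (stem ℓ′) ≡ true) (sym decoded) y∈W

Universal-universal : ∀ V → IsGδ V → ∃ λ x → SameSection Universal x V
Universal-universal V (W , V≡⋂W) = code W , λ y →
  (λ u → proj₂ (V≡⋂W y) (λ k → Hit-code⇒InOpen W y (u k 0))) ,
  (λ v k N → InOpen⇒Hit-code W y (proj₁ (V≡⋂W y) v k))

mainTheorem4 : Σ (Cantor → Cantor → Set) λ U → IsUniversalGδ U × (∀ x₁ x₂ → x₁ =* x₂ → SameSection U x₁ (U x₂))
mainTheorem4 = Universal , (Universal-isGδ₂ , Universal-universal) ,
  λ x₁ x₂ x₁=*x₂ y → Universal-=* x₁=*x₂ y , Universal-=* (=*-sym x₁=*x₂) y
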